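{- Let $n$ be a positive integer and let $(a_1,\dots,a_n)$ be chosen uniformly at random from $\{1,\dots,n\}^n$. Then $\mathbb{P}\big[\sum_ia_i=n(n+1)/2\big]\ge n^{ -3/2}/4$. -}

module Defs where

open import Data.Nat using (ℕ; zero; suc; _*_; _/_; _≟_)
open import Data.List using (List; []; _∷_; map; concatMap; upTo; filter; length)
open import Data.Vec using (Vec; []; _∷_; sum)
open import Relation.Binary.PropositionalEquality using (_≡_)

allVecs : (n k : ℕ) → List (Vec ℕ k)
allVecs n zero    = [] ∷ []
allVecs n (suc k) = concatMap (λ a → map (a ∷_) (allVecs n k)) (map suc (upTo n))

goodCount : ℕ → ℕ
goodCount n = length (filter (λ v → sum v ≟ n * suc n / 2) (allVecs n n))

-- Let S = a₁ + ⋯ + aₙ and c = n(n+1)/2. The number of tuples with S = s is an n-fold convolution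
-- of the indicator of {1,…,n}, and convolving with that indicator keeps a sequence symmetric and
-- unimodal; so no value of S is taken more than goodCount n times. The steps 2aᵢ − (n+1) are
-- independent and centred, so their variances add: Σ (S − c)² = nⁿ · n(n² − 1)/12 < nⁿ · n³/12.
-- For q with q² ≤ n³ ≤ 6q², Chebyshev's inequality puts at least half of the nⁿ tuples at
-- |S − c| < q, that is on at most 2q − 1 values of S. Hence nⁿ ≤ 4q · goodCount n, and squaring
-- gives n²ⁿ ≤ 16q² · (goodCount n)² ≤ 16n³ · (goodCount n)².

module Submission where

open import Defs
open import Algebra.Bundles using (CommutativeSemiring)
open import Data.Integer as ℤ using (ℤ; +_; -[1+_]; 0ℤ; 1ℤ; ∣_∣)
import Data.Integer.Properties as ℤP
open import Data.Integer.Tactic.RingSolver using (solve-∀)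
open import Data.List using (List; []; _∷_; _++_; [_]; map; concatMap; upTo; applyUpTo; filter; length)
open import Data.List.Properties using (upTo-∷ʳ; map-upTo; length-upTo)
open import Data.Nat as ℕ using (ℕ; zero; suc; _∸_)
import Data.Nat.Properties as ℕP
open import Data.Product using (∃-syntax; _×_; _,_)
open import Data.Vec using (Vec; []; _∷_; sum)
open import Function using (_∘_)
import Relation.Binary.PropositionalEquality as ≡
open import Relation.Nullary using (Dec; yes; no)
open import Data.Empty using (⊥-elim)
open import Level using (0ℓ)
open import Relation.Unary using (Pred; Decidable)

module ListSum {c ℓ} (R : CommutativeSemiring c ℓ) where

  open CommutativeSemiring R
  open import Algebra.Properties.CommutativeSemigroup +-commutativeSemigroup using (interchange)
  open import Relation.Binary.Reasoning.Setoid setoid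

  private variable A B : Set

  ∑ : (A → Carrier) → List A → Carrier
  ∑ f []       = 0#
  ∑ f (x ∷ xs) = f x + ∑ f xs

  ∑-cong : {f g : A → Carrier} → (∀ x → f x ≈ g x) → ∀ xs → ∑ f xs ≈ ∑ g xs
  ∑-cong f≈g []       = refl
  ∑-cong f≈g (x ∷ xs) = +-cong (f≈g x) (∑-cong f≈g xs)

  ∑-++ : (f : A → Carrier) (xs ys : List A) → ∑ f (xs ++ ys) ≈ ∑ f xs + ∑ f ys
  ∑-++ f []       ys = sym (+-identityˡ _)
  ∑-++ f (x ∷ xs) ys = trans (+-congˡ (∑-++ f xs ys)) (sym (+-assoc _ _ _))

  ∑-+ : (f g : A → Carrier) (xs : List A) → ∑ (λ x → f x + g x) xs ≈ ∑ f xs + ∑ g xs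
  ∑-+ f g []       = sym (+-identityˡ _)
  ∑-+ f g (x ∷ xs) = trans (+-congˡ (∑-+ f g xs)) (interchange _ _ _ _)

  ∑-*ˡ : (a : Carrier) (f : A → Carrier) (xs : List A) → ∑ (λ x → a * f x) xs ≈ a * ∑ f xs
  ∑-*ˡ a f []       = sym (zeroʳ a)
  ∑-*ˡ a f (x ∷ xs) = trans (+-congˡ (∑-*ˡ a f xs)) (sym (distribˡ a _ _))

  ∑-*ʳ : (a : Carrier) (f : A → Carrier) (xs : List A) → ∑ (λ x → f x * a) xs ≈ ∑ f xs * a
  ∑-*ʳ a f xs = trans (∑-cong (λ x → *-comm (f x) a) xs) (trans (∑-*ˡ a f xs) (*-comm a _))

  ∑-const : (a : Carrier) (xs : List A) → ∑ (λ _ → a) xs ≈ a * ∑ (λ _ → 1#) xs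
  ∑-const a xs = trans (∑-cong (λ _ → sym (*-identityʳ a)) xs) (∑-*ˡ a (λ _ → 1#) xs)

  ∑-map : (f : B → Carrier) (g : A → B) (xs : List A) → ∑ f (map g xs) ≈ ∑ (f ∘ g) xs
  ∑-map f g []       = refl
  ∑-map f g (x ∷ xs) = +-congˡ (∑-map f g xs)

  ∑-concatMap : (f : B → Carrier) (g : A → List B) (xs : List A) →
                ∑ f (concatMap g xs) ≈ ∑ (∑ f ∘ g) xs
  ∑-concatMap f g []       = refl
  ∑-concatMap f g (x ∷ xs) = trans (∑-++ f (g x) _) (+-congˡ (∑-concatMap f g xs))

  ∑-comm : (h : A → B → Carrier) (xs : List A) (ys : List B) →
           ∑ (λ x → ∑ (h x) ys) xs ≈ ∑ (λ y → ∑ (λ x → h x y) xs) ys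
  ∑-comm h []       ys = sym (trans (∑-const 0# ys) (zeroˡ _))
  ∑-comm h (x ∷ xs) ys =
    trans (+-congˡ (∑-comm h xs ys)) (sym (∑-+ (h x) (λ y → ∑ (λ x → h x y) xs) ys))

  ∑< : ℕ → (ℕ → Carrier) → Carrier
  ∑< n f = ∑ f (upTo n)

  ∑<-suc : ∀ n (f : ℕ → Carrier) → ∑< (suc n) f ≈ f 0 + ∑< n (f ∘ suc)
  ∑<-suc n f = +-congˡ (begin
    ∑ f (applyUpTo suc n)  ≡⟨ ≡.cong (∑ f) (≡.sym (map-upTo suc n)) ⟩
    ∑ f (map suc (upTo n)) ≈⟨ ∑-map f suc (upTo n) ⟩
    ∑< n (f ∘ suc)         ∎)

  ∑<-snoc : ∀ n (f : ℕ → Carrier) → ∑< (suc n) f ≈ ∑< n f + f n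
  ∑<-snoc n f = begin
    ∑ f (upTo (suc n))        ≡⟨ ≡.cong (∑ f) (≡.sym (upTo-∷ʳ n)) ⟩
    ∑ f (upTo n ++ [ n ])     ≈⟨ ∑-++ f (upTo n) [ n ] ⟩
    ∑< n f + (f n + 0#)       ≈⟨ +-congˡ (+-identityʳ (f n)) ⟩
    ∑< n f + f n              ∎

  ∑<-cong : ∀ n {f g : ℕ → Carrier} → (∀ i → i ℕ.< n → f i ≈ g i) → ∑< n f ≈ ∑< n g
  ∑<-cong zero    f≈g = refl
  ∑<-cong (suc n) {f} {g} f≈g = begin
    ∑< (suc n) f        ≈⟨ ∑<-suc n f ⟩
    f 0 + ∑< n (f ∘ suc) ≈⟨ +-cong (f≈g 0 (ℕ.s≤s ℕ.z≤n)) (∑<-cong n (λ i i<n → f≈g (suc i) (ℕ.s≤s i<n))) ⟩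
    g 0 + ∑< n (g ∘ suc) ≈⟨ sym (∑<-suc n g) ⟩
    ∑< (suc n) g        ∎

  ∑<-reverse : ∀ n (f : ℕ → Carrier) → ∑< n f ≈ ∑< n (λ i → f (n ∸ suc i))
  ∑<-reverse zero    f = refl
  ∑<-reverse (suc n) f = begin
    ∑< (suc n) f                                 ≈⟨ ∑<-suc n f ⟩
    f 0 + ∑< n (f ∘ suc)                         ≈⟨ +-congˡ (∑<-reverse n (f ∘ suc)) ⟩
    f 0 + ∑< n (λ i → f (suc (n ∸ suc i)))
      ≈⟨ +-congˡ (∑<-cong n (λ i i<n → reflexive (≡.cong f (≡.sym (ℕP.+-∸-assoc 1 i<n))))) ⟩
    f 0 + ∑< n (λ i → f (suc n ∸ suc i))         ≈⟨ +-comm _ _ ⟩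
    ∑< n (λ i → f (suc n ∸ suc i)) + f 0
      ≡⟨ ≡.cong (λ j → ∑< n (λ i → f (suc n ∸ suc i)) + f j) (≡.sym (ℕP.n∸n≡0 n)) ⟩
    ∑< n (λ i → f (suc n ∸ suc i)) + f (n ∸ n)   ≈⟨ sym (∑<-snoc n (λ i → f (suc n ∸ suc i))) ⟩
    ∑< (suc n) (λ i → f (suc n ∸ suc i))         ∎

  ∑-allVecs-suc : ∀ n k (f : Vec ℕ (suc k) → Carrier) →
                  ∑ f (allVecs n (suc k)) ≈ ∑< n (λ i → ∑ (λ v → f (suc i ∷ v)) (allVecs n k))
  ∑-allVecs-suc n k f = begin
    ∑ f (allVecs n (suc k))                                  ≈⟨ ∑-concatMap f _ (map suc (upTo n)) ⟩
    ∑ (λ a → ∑ f (map (a ∷_) (allVecs n k))) (map suc (upTo n)) ≈⟨ ∑-map _ suc (upTo n) ⟩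
    ∑< n (λ i → ∑ f (map (suc i ∷_) (allVecs n k)))
      ≈⟨ ∑-cong (λ i → ∑-map f (suc i ∷_) (allVecs n k)) (upTo n) ⟩
    ∑< n (λ i → ∑ (λ v → f (suc i ∷ v)) (allVecs n k))        ∎

open ≡ using (_≡_; refl; cong; cong₂; module ≡-Reasoning)

module ℤ∑ = ListSum ℤP.+-*-commutativeSemiring

module Moments where

  open import Data.Integer using (_+_; _-_; _*_)
  open ℤ∑
  open ≡-Reasoning

  walk : ∀ {k} → (ℕ → ℤ) → Vec ℕ k → ℤ
  walk g []      = 0ℤ
  walk g (a ∷ v) = g a + walk g v

  ∑-1 : {A : Set} (xs : List A) → ∑ (λ _ → 1ℤ) xs ≡ + length xs
  ∑-1 []       = refl
  ∑-1 (x ∷ xs) = cong (λ m → 1ℤ + m) (∑-1 xs)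

  ∑-const-upTo : ∀ n a → ∑< n (λ _ → a) ≡ a * + n
  ∑-const-upTo n a = ≡.trans (∑-const a (upTo n)) (cong (a *_) (≡.trans (∑-1 (upTo n)) (cong +_ (length-upTo n))))

  ∑-const-allVecs : ∀ n k a → ∑ (λ _ → a) (allVecs n k) ≡ a * + (n ℕ.^ k)
  ∑-const-allVecs n zero    a = ≡.trans (ℤP.+-identityʳ a) (≡.sym (ℤP.*-identityʳ a))
  ∑-const-allVecs n (suc k) a = begin
    ∑ (λ _ → a) (allVecs n (suc k))                     ≡⟨ ∑-allVecs-suc n k _ ⟩
    ∑< n (λ _ → ∑ (λ _ → a) (allVecs n k))              ≡⟨ ∑-const-upTo n _ ⟩
    ∑ (λ _ → a) (allVecs n k) * + n                     ≡⟨ cong (_* + n) (∑-const-allVecs n k a) ⟩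
    a * + (n ℕ.^ k) * + n                               ≡⟨ rearrange a (+ (n ℕ.^ k)) (+ n) ⟩
    a * (+ n * + (n ℕ.^ k))                             ≡⟨ cong (a *_) (ℤP.pos-* n (n ℕ.^ k)) ⟨
    a * + (n ℕ.^ suc k)                                 ∎
    where
    rearrange : ∀ a N n → a * N * n ≡ a * (n * N)
    rearrange = solve-∀

  module _ (n : ℕ) (g : ℕ → ℤ) (centred : ∑< n (g ∘ suc) ≡ 0ℤ) where

    ∑-walk : ∀ k → ∑ (walk g) (allVecs n k) ≡ 0ℤ
    ∑-walk zero    = refl
    ∑-walk (suc k) = begin
      ∑ (walk g) (allVecs n (suc k))                                 ≡⟨ ∑-allVecs-suc n k _ ⟩
      ∑< n (λ i → ∑ (λ v → g (suc i) + walk g v) (allVecs n k))      ≡⟨ ∑-cong (λ i → ∑-+ _ _ (allVecs n k)) (upTo n) ⟩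
      ∑< n (λ i → ∑ (λ _ → g (suc i)) (allVecs n k) + ∑ (walk g) (allVecs n k))
        ≡⟨ ∑-cong (λ i → cong₂ _+_ (∑-const-allVecs n k (g (suc i))) (∑-walk k)) (upTo n) ⟩
      ∑< n (λ i → g (suc i) * N + 0ℤ)                                ≡⟨ ∑-cong (λ i → ℤP.+-identityʳ _) (upTo n) ⟩
      ∑< n (λ i → g (suc i) * N)                                     ≡⟨ ∑-*ʳ N (g ∘ suc) (upTo n) ⟩
      ∑< n (g ∘ suc) * N                                             ≡⟨ cong (_* N) centred ⟩
      0ℤ * N                                                         ≡⟨ ℤP.*-zeroˡ N ⟩
      0ℤ                                                             ∎
      where N = + (n ℕ.^ k)

    ∑-walk²-suc : ∀ k → ∑ (λ v → walk g v * walk g v) (allVecs n (suc k)) ≡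
                  + (n ℕ.^ k) * ∑< n (λ i → g (suc i) * g (suc i))
                    + ∑ (λ v → walk g v * walk g v) (allVecs n k) * + n
    ∑-walk²-suc k = begin
      ∑ (λ v → walk g v * walk g v) (allVecs n (suc k))                        ≡⟨ ∑-allVecs-suc n k _ ⟩
      ∑< n (λ i → ∑ (λ v → (g (suc i) + walk g v) * (g (suc i) + walk g v)) V)
        ≡⟨ ∑-cong (λ i → row (g (suc i))) (upTo n) ⟩
      ∑< n (λ i → N * (g (suc i) * g (suc i)) + S)                             ≡⟨ ∑-+ _ _ (upTo n) ⟩
      ∑< n (λ i → N * (g (suc i) * g (suc i))) + ∑< n (λ _ → S)
        ≡⟨ cong₂ _+_ (∑-*ˡ N _ (upTo n)) (∑-const-upTo n S) ⟩
      N * ∑< n (λ i → g (suc i) * g (suc i)) + S * + n                         ∎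
      where
      V = allVecs n k
      N = + (n ℕ.^ k)
      S = ∑ (λ v → walk g v * walk g v) V
      square : ∀ x w → (x + w) * (x + w) ≡ x * x + (+ 2 * x) * w + w * w
      square = solve-∀
      row : ∀ x → ∑ (λ v → (x + walk g v) * (x + walk g v)) V ≡ N * (x * x) + S
      row x = begin
        ∑ (λ v → (x + walk g v) * (x + walk g v)) V                          ≡⟨ ∑-cong (λ v → square x (walk g v)) V ⟩
        ∑ (λ v → x * x + (+ 2 * x) * walk g v + walk g v * walk g v) V       ≡⟨ ∑-+ _ _ V ⟩
        ∑ (λ v → x * x + (+ 2 * x) * walk g v) V + S                         ≡⟨ cong (_+ S) (∑-+ _ _ V) ⟩
        ∑ (λ _ → x * x) V + ∑ (λ v → (+ 2 * x) * walk g v) V + S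
          ≡⟨ cong (λ t → ∑ (λ _ → x * x) V + t + S) (∑-*ˡ (+ 2 * x) (walk g) V) ⟩
        ∑ (λ _ → x * x) V + (+ 2 * x) * ∑ (walk g) V + S
          ≡⟨ cong₂ (λ a b → a + (+ 2 * x) * b + S) (∑-const-allVecs n k (x * x)) (∑-walk k) ⟩
        x * x * N + (+ 2 * x) * 0ℤ + S                                       ≡⟨ tidy (x * x) (+ 2 * x) N S ⟩
        N * (x * x) + S                                                      ∎
        where
        tidy : ∀ a b N S → a * N + b * 0ℤ + S ≡ N * a + S
        tidy = solve-∀

    ∑-walk² : ∀ k → ∑ (λ v → walk g v * walk g v) (allVecs n (suc k)) ≡
              + suc k * + (n ℕ.^ k) * ∑< n (λ i → g (suc i) * g (suc i))
    ∑-walk² zero    = ≡.trans (∑-walk²-suc 0) (base (∑< n (λ i → g (suc i) * g (suc i))) (+ n))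
      where
      base : ∀ G n → + 1 * G + 0ℤ * n ≡ + 1 * + 1 * G
      base = solve-∀
    ∑-walk² (suc k) = begin
      ∑ (λ v → walk g v * walk g v) (allVecs n (suc (suc k)))          ≡⟨ ∑-walk²-suc (suc k) ⟩
      + (n ℕ.^ suc k) * G + ∑ (λ v → walk g v * walk g v) (allVecs n (suc k)) * + n
        ≡⟨ cong₂ (λ a b → a * G + b * + n) (ℤP.pos-* n (n ℕ.^ k)) (∑-walk² k) ⟩
      + n * N * G + + suc k * N * G * + n                              ≡⟨ step (+ n) N G (+ k) ⟩
      + suc (suc k) * (+ n * N) * G
        ≡⟨ cong (λ a → + suc (suc k) * a * G) (ℤP.pos-* n (n ℕ.^ k)) ⟨
      + suc (suc k) * + (n ℕ.^ suc k) * G                              ∎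
      where
      N = + (n ℕ.^ k)
      G = ∑< n (λ i → g (suc i) * g (suc i))
      step : ∀ n N G k → n * N * G + (+ 1 + k) * N * G * n ≡ (+ 1 + (+ 1 + k)) * (n * N) * G
      step = solve-∀

  ∑<-id : ∀ m → + 2 * ∑< m (λ i → + i) ≡ + m * (+ m - 1ℤ)
  ∑<-id zero    = refl
  ∑<-id (suc m) = begin
    + 2 * ∑< (suc m) (λ i → + i)      ≡⟨ cong (+ 2 *_) (∑<-snoc m _) ⟩
    + 2 * (∑< m (λ i → + i) + + m)    ≡⟨ ℤP.*-distribˡ-+ (+ 2) (∑< m (λ i → + i)) (+ m) ⟩
    + 2 * ∑< m (λ i → + i) + + 2 * + m ≡⟨ cong (_+ + 2 * + m) (∑<-id m) ⟩
    + m * (+ m - 1ℤ) + + 2 * + m      ≡⟨ step (+ m) ⟩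
    + suc m * (+ suc m - 1ℤ)          ∎
    where
    step : ∀ m → m * (m - 1ℤ) + + 2 * m ≡ (1ℤ + m) * ((1ℤ + m) - 1ℤ)
    step = solve-∀

  ∑<-square : ∀ m → + 6 * ∑< m (λ i → + i * + i) ≡ (+ m - 1ℤ) * + m * (+ 2 * + m - 1ℤ)
  ∑<-square zero    = refl
  ∑<-square (suc m) = begin
    + 6 * ∑< (suc m) (λ i → + i * + i)                ≡⟨ cong (+ 6 *_) (∑<-snoc m _) ⟩
    + 6 * (∑< m (λ i → + i * + i) + + m * + m)        ≡⟨ ℤP.*-distribˡ-+ (+ 6) (∑< m (λ i → + i * + i)) (+ m * + m) ⟩
    + 6 * ∑< m (λ i → + i * + i) + + 6 * (+ m * + m)  ≡⟨ cong (_+ + 6 * (+ m * + m)) (∑<-square m) ⟩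
    (+ m - 1ℤ) * + m * (+ 2 * + m - 1ℤ) + + 6 * (+ m * + m) ≡⟨ step (+ m) ⟩
    (+ suc m - 1ℤ) * + suc m * (+ 2 * + suc m - 1ℤ)   ∎
    where
    step : ∀ m → (m - 1ℤ) * m * (+ 2 * m - 1ℤ) + + 6 * (m * m) ≡
                 ((1ℤ + m) - 1ℤ) * (1ℤ + m) * (+ 2 * (1ℤ + m) - 1ℤ)
    step = solve-∀

  -- Twice the deviation of a digit a from the mean (n+1)/2, doubled to stay integral.
  dev : ℕ → ℕ → ℤ
  dev n a = + 2 * + a - + suc n

  ∑<-dev : ∀ n → ∑< n (dev n ∘ suc) ≡ 0ℤ
  ∑<-dev n = begin
    ∑< n (dev n ∘ suc)                                      ≡⟨ ∑-cong (λ i → affine (+ i) (+ n)) (upTo n) ⟩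
    ∑< n (λ i → + 2 * + i + (1ℤ - + n))                     ≡⟨ ∑-+ _ _ (upTo n) ⟩
    ∑< n (λ i → + 2 * + i) + ∑< n (λ _ → 1ℤ - + n)          ≡⟨ cong₂ _+_ (∑-*ˡ (+ 2) +_ (upTo n)) (∑-const-upTo n _) ⟩
    + 2 * ∑< n (λ i → + i) + (1ℤ - + n) * + n               ≡⟨ cong (_+ (1ℤ - + n) * + n) (∑<-id n) ⟩
    + n * (+ n - 1ℤ) + (1ℤ - + n) * + n                     ≡⟨ cancel (+ n) ⟩
    0ℤ                                                      ∎
    where
    affine : ∀ i n → + 2 * (1ℤ + i) - (1ℤ + n) ≡ + 2 * i + (1ℤ - n)
    affine = solve-∀
    cancel : ∀ n → n * (n - 1ℤ) + (1ℤ - n) * n ≡ 0ℤ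
    cancel = solve-∀

  ∑<-dev² : ∀ n → + 3 * ∑< n (λ i → dev n (suc i) * dev n (suc i)) ≡ + n * (+ n * + n - 1ℤ)
  ∑<-dev² n = begin
    + 3 * ∑< n (λ i → dev n (suc i) * dev n (suc i))
      ≡⟨ cong (+ 3 *_) (∑-cong (λ i → expand (+ i) (+ n)) (upTo n)) ⟩
    + 3 * ∑< n (λ i → + 4 * (+ i * + i) + (+ 4 * b * + i + b * b))
      ≡⟨ cong (+ 3 *_) (≡.trans (∑-+ _ _ (upTo n))
                                (cong (λ x → ∑< n (λ i → + 4 * (+ i * + i)) + x) (∑-+ _ _ (upTo n)))) ⟩
    + 3 * (∑< n (λ i → + 4 * (+ i * + i)) + (∑< n (λ i → + 4 * b * + i) + ∑< n (λ _ → b * b)))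
      ≡⟨ cong₂ (λ x y → + 3 * (x + y)) (∑-*ˡ (+ 4) _ (upTo n))
               (cong₂ _+_ (∑-*ˡ (+ 4 * b) +_ (upTo n)) (∑-const-upTo n (b * b))) ⟩
    + 3 * (+ 4 * A + (+ 4 * b * B + b * b * + n))
      ≡⟨ regroup A B b (+ n) ⟩
    + 2 * (+ 6 * A) + + 6 * b * (+ 2 * B) + + 3 * b * b * + n
      ≡⟨ cong₂ (λ x y → + 2 * x + + 6 * b * y + + 3 * b * b * + n) (∑<-square n) (∑<-id n) ⟩
    + 2 * ((+ n - 1ℤ) * + n * (+ 2 * + n - 1ℤ)) + + 6 * b * (+ n * (+ n - 1ℤ)) + + 3 * b * b * + n
      ≡⟨ closed (+ n) ⟩
    + n * (+ n * + n - 1ℤ)   ∎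
    where
    b = 1ℤ - + n
    A = ∑< n (λ i → + i * + i)
    B = ∑< n (λ i → + i)
    expand : ∀ i n → (+ 2 * (1ℤ + i) - (1ℤ + n)) * (+ 2 * (1ℤ + i) - (1ℤ + n)) ≡
                     + 4 * (i * i) + (+ 4 * (1ℤ - n) * i + (1ℤ - n) * (1ℤ - n))
    expand = solve-∀
    regroup : ∀ A B b n → + 3 * (+ 4 * A + (+ 4 * b * B + b * b * n)) ≡
                          + 2 * (+ 6 * A) + + 6 * b * (+ 2 * B) + + 3 * b * b * n
    regroup = solve-∀
    closed : ∀ n → + 2 * ((n - 1ℤ) * n * (+ 2 * n - 1ℤ)) + + 6 * (1ℤ - n) * (n * (n - 1ℤ))
                     + + 3 * (1ℤ - n) * (1ℤ - n) * n ≡ n * (n * n - 1ℤ)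
    closed = solve-∀

  walk-dev : ∀ n {k} (v : Vec ℕ k) → walk (dev n) v ≡ + 2 * + sum v - + k * + suc n
  walk-dev n []      = refl
  walk-dev n {suc k} (a ∷ v) =
    ≡.trans (cong (λ w → dev n a + w) (walk-dev n v)) (step (+ a) (+ sum v) (+ suc n) (+ k))
    where
    step : ∀ a s m k → (+ 2 * a - m) + (+ 2 * s - k * m) ≡ + 2 * (a + s) - (1ℤ + k) * m
    step = solve-∀

  ∑-walk-dev² : ∀ n k → + 3 * ∑ (λ v → walk (dev n) v * walk (dev n) v) (allVecs n (suc k)) ≡
                        + suc k * + (n ℕ.^ k) * (+ n * (+ n * + n - 1ℤ))
  ∑-walk-dev² n k = begin
    + 3 * ∑ (λ v → walk (dev n) v * walk (dev n) v) (allVecs n (suc k))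
      ≡⟨ cong (+ 3 *_) (∑-walk² n (dev n) (∑<-dev n) k) ⟩
    + 3 * (+ suc k * + (n ℕ.^ k) * G)                                    ≡⟨ reassoc (+ suc k * + (n ℕ.^ k)) G ⟩
    + suc k * + (n ℕ.^ k) * (+ 3 * G)
      ≡⟨ cong (+ suc k * + (n ℕ.^ k) *_) (∑<-dev² n) ⟩
    + suc k * + (n ℕ.^ k) * (+ n * (+ n * + n - 1ℤ))                     ∎
    where
    G = ∑< n (λ i → dev n (suc i) * dev n (suc i))
    reassoc : ∀ a G → + 3 * (a * G) ≡ a * (+ 3 * G)
    reassoc = solve-∀

  ∑-centred² : ∀ m c → + suc m * + suc (suc m) ≡ + 2 * c →
               + 12 * ∑ (λ v → (+ sum v - c) * (+ sum v - c)) (allVecs (suc m) (suc m)) ≡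
               + (suc m ℕ.^ suc m) * (+ suc m * (+ suc m * + suc m - 1ℤ))
  ∑-centred² m c n[n+1]≡2c = begin
    + 12 * ∑ (λ v → Y v * Y v) V                ≡⟨ ℤP.*-assoc (+ 3) (+ 4) _ ⟩
    + 3 * (+ 4 * ∑ (λ v → Y v * Y v) V)         ≡⟨ cong (+ 3 *_) (∑-*ˡ (+ 4) _ V) ⟨
    + 3 * ∑ (λ v → + 4 * (Y v * Y v)) V         ≡⟨ cong (+ 3 *_) (∑-cong (λ v → ≡.sym (double v)) V) ⟩
    + 3 * ∑ (λ v → walk (dev n) v * walk (dev n) v) V ≡⟨ ∑-walk-dev² n m ⟩
    + suc m * + (n ℕ.^ m) * (+ n * (+ n * + n - 1ℤ)) ≡⟨ cong (_* (+ n * (+ n * + n - 1ℤ))) (ℤP.pos-* n (n ℕ.^ m)) ⟨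
    + (n ℕ.^ n) * (+ n * (+ n * + n - 1ℤ))       ∎
    where
    n = suc m
    V = allVecs n n
    Y : Vec ℕ n → ℤ
    Y v = + sum v - c
    square-twice : ∀ s c → (+ 2 * s - + 2 * c) * (+ 2 * s - + 2 * c) ≡ + 4 * ((s - c) * (s - c))
    square-twice = solve-∀
    double : ∀ v → walk (dev n) v * walk (dev n) v ≡ + 4 * (Y v * Y v)
    double v = ≡.trans (cong (λ x → x * x) (≡.trans (walk-dev n v) (cong (λ x → + 2 * + sum v - x) n[n+1]≡2c)))
                       (square-twice (+ sum v) c)

open ListSum ℕP.+-*-commutativeSemiring

𝟙 : {P : Set} → Dec P → ℕ
𝟙 (yes _) = 1
𝟙 (no _)  = 0

𝟙-cong : {P Q : Set} (p : Dec P) (q : Dec Q) → (P → Q) → (Q → P) → 𝟙 p ≡ 𝟙 q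
𝟙-cong (yes _) (yes _) _   _   = refl
𝟙-cong (yes p) (no ¬q) p→q _   = ⊥-elim (¬q (p→q p))
𝟙-cong (no ¬p) (yes q) _   q→p = ⊥-elim (¬p (q→p q))
𝟙-cong (no _)  (no _)  _   _   = refl

𝟙-yes : {P : Set} (p : Dec P) → P → 𝟙 p ≡ 1
𝟙-yes (yes _) _  = refl
𝟙-yes (no ¬p) p = ⊥-elim (¬p p)

count : {A : Set} {P : Pred A 0ℓ} → Decidable P → List A → ℕ
count P? = ∑ (λ x → 𝟙 (P? x))

pos-∸ : ∀ {m n} → m ℕ.≤ n → + (n ∸ m) ≡ + n ℤ.- + m
pos-∸ {m} {n} m≤n = ≡.sym (≡.trans (ℤP.[+m]-[+n]≡m⊖n n m) (ℤP.⊖-≥ m≤n))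

module Unimodality where

  open import Data.Integer using (_+_; _-_; _*_; _≤_; -1ℤ)

  -- K is twice the centre of symmetry, which may be a half-integer.
  record SymmetricUnimodal (F : ℤ → ℕ) (K : ℤ) : Set where
    field
      symmetric  : ∀ s → F (K - s) ≡ F s
      increasing : ∀ s → + 2 * s + + 2 ≤ K → F s ℕ.≤ F (s + 1ℤ)

  module _ {F : ℤ → ℕ} {K : ℤ} (U : SymmetricUnimodal F K) where

    open SymmetricUnimodal U

    increasing-to : ∀ j t → + 2 * t ≤ K → F (t - + j) ℕ.≤ F t
    increasing-to zero    t 2t≤K = ℕP.≤-reflexive (cong F (ℤP.+-identityʳ t))
    increasing-to (suc j) t 2t≤K = ℕP.≤-trans
      (ℕP.≤-trans (increasing s 2s+2≤K) (ℕP.≤-reflexive (cong F (next t (+ j)))))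
      (increasing-to j t 2t≤K)
      where
      s = t - + suc j
      next : ∀ t j → t - (1ℤ + j) + 1ℤ ≡ t - j
      next = solve-∀
      shrink : ∀ t j → + 2 * (t - (1ℤ + j)) + + 2 ≡ + 2 * t - + 2 * j
      shrink = solve-∀
      2s+2≤K : + 2 * s + + 2 ≤ K
      2s+2≤K = ℤP.≤-trans
        (ℤP.≤-reflexive (≡.trans (shrink t (+ j)) (cong (λ x → + 2 * t - x) (≡.sym (ℤP.pos-* 2 j)))))
        (ℤP.≤-trans (ℤP.i-j≤i (+ 2 * t) (+ (2 ℕ.* j))) 2t≤K)

    -- Past the centre, s is compared through its mirror image K − s.
    shift-≤ : ∀ m s → + 2 * s ≤ K + + m → F (s - + m) ℕ.≤ F s
    shift-≤ m s 2s≤K+m with + 2 * s ℤP.≤? K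
    ... | yes 2s≤K = increasing-to m s 2s≤K
    ... | no  2s≰K = begin
      F (s - + m)          ≡⟨ cong F reflect ⟩
      F (K - s - + j)      ≤⟨ increasing-to j (K - s) 2t≤K ⟩
      F (K - s)            ≡⟨ symmetric s ⟩
      F s                  ∎
      where
      open ℕP.≤-Reasoning
      j = ∣ + 2 * s - (K + + m) ∣
      i = ∣ K - + 2 * s ∣
      reflect : s - + m ≡ K - s - + j
      reflect = ≡.sym (≡.trans (cong (λ x → K - s - x) (ℤP.∣-∣-≤ 2s≤K+m)) (flip s K (+ m)))
        where
        flip : ∀ s K m → K - s - (K + m - + 2 * s) ≡ s - m
        flip = solve-∀
      2t≤K : + 2 * (K - s) ≤ K
      2t≤K = ℤP.≤-trans
        (ℤP.≤-reflexive (≡.trans (halve s K) (cong (λ x → K - x) (≡.sym (ℤP.∣-∣-≤ K≤2s)))))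
        (ℤP.i-j≤i K (+ i))
        where
        K≤2s = ℤP.<⇒≤ (ℤP.≰⇒> 2s≰K)
        halve : ∀ s K → + 2 * (K - s) ≡ K - (+ 2 * s - K)
        halve = solve-∀

    centre-max : ∀ c → K ≡ + 2 * c → ∀ s → F s ℕ.≤ F c
    centre-max c K≡2c s with s ℤP.≤? c
    ... | yes s≤c = begin
      F s                  ≡⟨ cong F (≡.sym (≡.trans (cong (λ x → c - x) (ℤP.∣-∣-≤ s≤c)) (back c s))) ⟩
      F (c - + ∣ s - c ∣)  ≤⟨ increasing-to _ c (ℤP.≤-reflexive (≡.sym K≡2c)) ⟩
      F c                  ∎
      where
      open ℕP.≤-Reasoning
      back : ∀ c s → c - (c - s) ≡ s
      back = solve-∀
    ... | no  s≰c = begin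
      F s                  ≡⟨ symmetric s ⟨
      F (K - s)
        ≡⟨ cong F (≡.sym (≡.trans (cong (λ x → c - x) (ℤP.∣-∣-≤ c≤s))
                                  (≡.trans (mirror c s) (cong (_- s) (≡.sym K≡2c))))) ⟩
      F (c - + ∣ c - s ∣)  ≤⟨ increasing-to _ c (ℤP.≤-reflexive (≡.sym K≡2c)) ⟩
      F c                  ∎
      where
      open ℕP.≤-Reasoning
      c≤s = ℤP.<⇒≤ (ℤP.≰⇒> s≰c)
      mirror : ∀ c s → c - (s - c) ≡ + 2 * c - s
      mirror = solve-∀

  unimodal-resp : ∀ {F G K L} → (∀ s → F s ≡ G s) → K ≡ L → SymmetricUnimodal F K → SymmetricUnimodal G L
  unimodal-resp {F} {G} F≗G refl U = record
    { symmetric  = λ s → ≡.trans (≡.sym (F≗G _)) (≡.trans (symmetric s) (F≗G s))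
    ; increasing = λ s h → ≡.subst₂ ℕ._≤_ (F≗G s) (F≗G _) (increasing s h)
    }
    where open SymmetricUnimodal U

  pointMass-unimodal : SymmetricUnimodal (λ s → 𝟙 (0ℤ ℤ.≟ s)) 0ℤ
  pointMass-unimodal = record
    { symmetric  = λ s → 𝟙-cong _ _ (λ 0≡-s → ≡.sym (≡.trans (negate-twice s) (cong (λ x → 0ℤ - x) (≡.sym 0≡-s))))
                                   (λ { refl → refl })
    ; increasing = increasing₀
    }
    where
    negate-twice : ∀ s → s ≡ 0ℤ - (0ℤ - s)
    negate-twice = solve-∀
    increasing₀ : ∀ s → + 2 * s + + 2 ≤ 0ℤ → 𝟙 (0ℤ ℤ.≟ s) ℕ.≤ 𝟙 (0ℤ ℤ.≟ (s + 1ℤ))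
    increasing₀ s h with 0ℤ ℤ.≟ s
    ... | yes refl = ⊥-elim (ℕP.n≮0 (ℤP.drop‿+≤+ h))
    ... | no  _    = ℕ.z≤n

  convolve : ℕ → (ℤ → ℕ) → ℤ → ℕ
  convolve n F s = ∑< n (λ i → F (s - + suc i))

  convolve-unimodal : ∀ n {F K} → SymmetricUnimodal F K → SymmetricUnimodal (convolve n F) (K + + suc n)
  convolve-unimodal n {F} {K} U = record { symmetric = symmetric′ ; increasing = increasing′ n }
    where
    open SymmetricUnimodal U

    symmetric′ : ∀ s → convolve n F (K + + suc n - s) ≡ convolve n F s
    symmetric′ s = begin
      ∑< n (λ i → F (K + + suc n - s - + suc i))              ≡⟨ ∑<-reverse n _ ⟩
      ∑< n (λ i → F (K + + suc n - s - + suc (n ∸ suc i)))    ≡⟨ ∑<-cong n (λ i i<n → cong F (reflect i i<n)) ⟩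
      ∑< n (λ i → F (K - (s - + suc i)))                      ≡⟨ ∑-cong (λ i → symmetric (s - + suc i)) (upTo n) ⟩
      convolve n F s                                          ∎
      where
      open ≡-Reasoning
      rearrange : ∀ K n s i → K + (1ℤ + n) - s - (n - i) ≡ K - (s - (1ℤ + i))
      rearrange = solve-∀
      reflect : ∀ i → i ℕ.< n → K + + suc n - s - + suc (n ∸ suc i) ≡ K - (s - + suc i)
      reflect i i<n = begin
        K + + suc n - s - + suc (n ∸ suc i) ≡⟨ cong (λ x → K + + suc n - s - + x) (≡.sym (ℕP.+-∸-assoc 1 i<n)) ⟩
        K + + suc n - s - + (n ∸ i)         ≡⟨ cong (λ x → K + + suc n - s - x) (pos-∸ (ℕP.<⇒≤ i<n)) ⟩
        K + + suc n - s - (+ n - + i)       ≡⟨ rearrange K (+ n) s (+ i) ⟩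
        K - (s - + suc i)                   ∎

    increasing′ : ∀ n s → + 2 * s + + 2 ≤ K + + suc n → convolve n F s ℕ.≤ convolve n F (s + 1ℤ)
    increasing′ zero    s _ = ℕ.z≤n
    increasing′ (suc m) s h = begin
      convolve (suc m) F s                                          ≡⟨ ∑<-snoc m _ ⟩
      ∑< m (λ i → F (s - + suc i)) ℕ.+ F (s - + suc m)              ≤⟨ ℕP.+-monoʳ-≤ _ (shift-≤ U (suc m) s 2s≤K+m) ⟩
      ∑< m (λ i → F (s - + suc i)) ℕ.+ F s                          ≡⟨ ℕP.+-comm _ (F s) ⟩
      F s ℕ.+ ∑< m (λ i → F (s - + suc i))
        ≡⟨ cong₂ ℕ._+_ (cong F (back s)) (∑-cong (λ i → cong F (back′ s (+ i))) (upTo m)) ⟩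
      F (s + 1ℤ - + 1) ℕ.+ ∑< m (λ i → F (s + 1ℤ - + suc (suc i))) ≡⟨ ∑<-suc m _ ⟨
      convolve (suc m) F (s + 1ℤ)                                   ∎
      where
      open ℕP.≤-Reasoning
      back : ∀ s → s ≡ s + 1ℤ - 1ℤ
      back = solve-∀
      back′ : ∀ s i → s - (1ℤ + i) ≡ s + 1ℤ - (1ℤ + (1ℤ + i))
      back′ = solve-∀
      drop-one : ∀ s → s + + 2 + -1ℤ ≡ s + 1ℤ
      drop-one = solve-∀
      drop-one′ : ∀ K m → K + (1ℤ + (1ℤ + m)) + -1ℤ ≡ K + (1ℤ + m)
      drop-one′ = solve-∀
      2s≤K+m : + 2 * s ≤ K + + suc m
      2s≤K+m = ℤP.≤-trans (ℤP.i≤i+j (+ 2 * s) 1ℤ)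
        (≡.subst₂ _≤_ (drop-one (+ 2 * s)) (drop-one′ K (+ m)) (ℤP.+-monoˡ-≤ -1ℤ h))

module SumCounts where

  open import Data.Integer using (_+_; _-_; _*_)
  open Unimodality

  sumCount : ℕ → ℕ → ℤ → ℕ
  sumCount n k s = count (λ v → + sum v ℤ.≟ s) (allVecs n k)

  sumCount-suc : ∀ n k s → sumCount n (suc k) s ≡ convolve n (sumCount n k) s
  sumCount-suc n k s = ≡.trans (∑-allVecs-suc n k _)
    (∑-cong (λ i → ∑-cong (λ v → 𝟙-cong _ _ (detach (+ suc i) (+ sum v)) (attach (+ suc i) (+ sum v)))
                          (allVecs n k))
            (upTo n))
    where
    cancel : ∀ a x → x ≡ a + x - a
    cancel = solve-∀
    restore : ∀ a s → a + (s - a) ≡ s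
    restore = solve-∀
    detach : ∀ a x → a + x ≡ s → x ≡ s - a
    detach a x e = ≡.trans (cancel a x) (cong (_- a) e)
    attach : ∀ a x → x ≡ s - a → a + x ≡ s
    attach a x e = ≡.trans (cong (λ y → a + y) e) (restore a s)

  sumCount-unimodal : ∀ n k → SymmetricUnimodal (sumCount n k) (+ k * + suc n)
  sumCount-unimodal n zero    = unimodal-resp (λ s → ≡.sym (ℕP.+-identityʳ _)) refl pointMass-unimodal
  sumCount-unimodal n (suc k) =
    unimodal-resp (λ s → ≡.sym (sumCount-suc n k s)) (grow (+ k) (+ suc n))
                  (convolve-unimodal n (sumCount-unimodal n k))
    where
    grow : ∀ k m → k * m + m ≡ (1ℤ + k) * m
    grow = solve-∀

  sumCount-≤-centre : ∀ n c → + n * + suc n ≡ + 2 * c → ∀ s → sumCount n n s ℕ.≤ sumCount n n c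
  sumCount-≤-centre n c = centre-max (sumCount-unimodal n n) c

open import Data.Nat using (_+_; _*_; _^_; _/_; _≤_; _<_; _≤?_; _<?_; z≤n; s≤s)
open import Data.Nat.DivMod using (m/n*n≡m)
open import Data.Nat.Divisibility using (_∣_; divides; ∣m∣n⇒∣m+n; m∣m*n)
import Data.Nat.Tactic.RingSolver as ℕ-Solver
open SumCounts using (sumCount; sumCount-≤-centre)

∑-1 : {A : Set} (xs : List A) → ∑ (λ _ → 1) xs ≡ length xs
∑-1 []       = refl
∑-1 (x ∷ xs) = cong suc (∑-1 xs)

∑-const-upTo : ∀ n a → ∑< n (λ _ → a) ≡ a * n
∑-const-upTo n a = ≡.trans (∑-const a (upTo n)) (cong (a *_) (≡.trans (∑-1 (upTo n)) (length-upTo n)))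

∑-mono : {A : Set} {f g : A → ℕ} → (∀ x → f x ≤ g x) → ∀ xs → ∑ f xs ≤ ∑ g xs
∑-mono f≤g []       = z≤n
∑-mono f≤g (x ∷ xs) = ℕP.+-mono-≤ (f≤g x) (∑-mono f≤g xs)

term-≤-∑< : ∀ {m} (f : ℕ → ℕ) {j} → j < m → f j ≤ ∑< m f
term-≤-∑< {suc m} f {j} j<1+m = ℕP.≤-trans (head-or-tail j j<1+m) (ℕP.≤-reflexive (≡.sym (∑<-suc m f)))
  where
  head-or-tail : ∀ j → j < suc m → f j ≤ f 0 + ∑< m (f ∘ suc)
  head-or-tail zero    _         = ℕP.m≤m+n (f 0) _
  head-or-tail (suc j) (s≤s j<m) = ℕP.≤-trans (term-≤-∑< (f ∘ suc) j<m) (ℕP.m≤n+m _ (f 0))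

length-filter≡count : {A : Set} {P : Pred A 0ℓ} (P? : Decidable P) (xs : List A) → length (filter P? xs) ≡ count P? xs
length-filter≡count P? []       = refl
length-filter≡count P? (x ∷ xs) with P? x
... | yes _ = cong suc (length-filter≡count P? xs)
... | no  _ = length-filter≡count P? xs

count-≤-∑< : {A : Set} {P : Pred A 0ℓ} {Q : ℕ → Pred A 0ℓ} (P? : Decidable P) (Q? : ∀ j → Decidable (Q j)) {m : ℕ} →
             (∀ x → P x → ∃[ j ] j < m × Q j x) → ∀ xs → count P? xs ≤ ∑< m (λ j → count (Q? j) xs)
count-≤-∑< P? Q? {m} cover xs = begin
  count P? xs                           ≤⟨ ∑-mono pointwise xs ⟩
  ∑ (λ x → ∑< m (λ j → 𝟙 (Q? j x))) xs  ≡⟨ ∑-comm (λ x j → 𝟙 (Q? j x)) xs (upTo m) ⟩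
  ∑< m (λ j → count (Q? j) xs)          ∎
  where
  open ℕP.≤-Reasoning
  pointwise : ∀ x → 𝟙 (P? x) ≤ ∑< m (λ j → 𝟙 (Q? j x))
  pointwise x with P? x
  ... | no  _  = z≤n
  ... | yes px with cover x px
  ...   | j , j<m , qjx =
    ℕP.≤-trans (ℕP.≤-reflexive (≡.sym (𝟙-yes (Q? j x) qjx))) (term-≤-∑< (λ j → 𝟙 (Q? j x)) j<m)

chebyshev : {A : Set} (h : A → ℕ) (t : ℕ) (xs : List A) →
            t * t * length xs ≤ ∑ (λ x → h x * h x) xs + t * t * count (λ x → h x <? t) xs
chebyshev h t xs = begin
  t * t * length xs                                            ≡⟨ cong (t * t *_) (∑-1 xs) ⟨
  t * t * ∑ (λ _ → 1) xs                                       ≡⟨ ∑-const (t * t) xs ⟨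
  ∑ (λ _ → t * t) xs                                           ≤⟨ ∑-mono pointwise xs ⟩
  ∑ (λ x → h x * h x + t * t * 𝟙 (h x <? t)) xs                ≡⟨ ∑-+ _ _ xs ⟩
  ∑ (λ x → h x * h x) xs + ∑ (λ x → t * t * 𝟙 (h x <? t)) xs
    ≡⟨ cong (λ y → ∑ (λ x → h x * h x) xs + y) (∑-*ˡ (t * t) _ xs) ⟩
  ∑ (λ x → h x * h x) xs + t * t * count (λ x → h x <? t) xs   ∎
  where
  open ℕP.≤-Reasoning
  pointwise : ∀ x → t * t ≤ h x * h x + t * t * 𝟙 (h x <? t)
  pointwise x with h x <? t
  ... | yes _   = ℕP.≤-trans (ℕP.≤-reflexive (≡.sym (ℕP.*-identityʳ (t * t)))) (ℕP.m≤n+m _ _)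
  ... | no  h≮t = ℕP.≤-trans (ℕP.*-mono-≤ t≤h t≤h) (ℕP.m≤m+n _ _)
    where t≤h = ℕP.≮⇒≥ h≮t

bracket : (f : ℕ → ℕ) → (∀ i → f i < f (suc i)) → ∀ x → f 0 ≤ x → ∃[ i ] f i ≤ x × x < f (suc i)
bracket f f↑ zero    f0≤0   = 0 , f0≤0 , ℕP.≤-<-trans z≤n (f↑ 0)
bracket f f↑ (suc x) f0≤1+x with f 0 ≤? x
... | no  f0≰x = 0 , f0≤1+x , ℕP.≤-<-trans (ℕP.≰⇒> f0≰x) (f↑ 0)
... | yes f0≤x with bracket f f↑ x f0≤x
...   | i , fi≤x , x<fi+1 with suc x <? f (suc i)
...     | yes 1+x<fi+1 = i , ℕP.m≤n⇒m≤1+n fi≤x , 1+x<fi+1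
...     | no  1+x≮fi+1 = suc i , ℕP.≮⇒≥ 1+x≮fi+1 , ℕP.≤-<-trans x<fi+1 (f↑ (suc i))

square-bracket : ∀ x → 1 ≤ x → ∃[ R ] suc R * suc R ≤ x × x ≤ 6 * (suc R * suc R)
square-bracket x 1≤x with bracket (λ i → suc i * suc i) square-< x 1≤x
  where
  square-< : ∀ i → suc i * suc i < suc (suc i) * suc (suc i)
  square-< i = ℕP.*-mono-< (ℕP.n<1+n (suc i)) (ℕP.n<1+n (suc i))
... | R , q²≤x , x<[q+1]² =
  R , q²≤x , ℕP.≤-trans (ℕP.<⇒≤ x<[q+1]²) (ℕP.≤-trans (ℕP.m≤m+n _ _) (ℕP.≤-reflexive (≡.sym (slack R))))
  where
  slack : ∀ R → 6 * (suc R * suc R) ≡ suc (suc R) * suc (suc R) + (5 * R * R + 8 * R + 2)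
  slack = ℕ-Solver.solve-∀

length-allVecs : ∀ n k → length (allVecs n k) ≡ n ^ k
length-allVecs n k = ℤP.+-injective
  (≡.trans (≡.sym (Moments.∑-1 (allVecs n k))) (≡.trans (Moments.∑-const-allVecs n k 1ℤ) (ℤP.*-identityˡ _)))

centre : ℕ → ℕ
centre n = n * suc n / 2

2∣n[1+n] : ∀ n → 2 ∣ n * suc n
2∣n[1+n] zero    = divides 0 refl
2∣n[1+n] (suc n) = ≡.subst (2 ∣_) (step n) (∣m∣n⇒∣m+n (2∣n[1+n] n) (m∣m*n (suc n)))
  where
  step : ∀ n → n * suc n + 2 * suc n ≡ suc n * suc (suc n)
  step = ℕ-Solver.solve-∀

centre*2 : ∀ n → centre n * 2 ≡ n * suc n
centre*2 n = m/n*n≡m (2∣n[1+n] n)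

n[1+n]≡2*centre : ∀ n → + n ℤ.* + suc n ≡ + 2 ℤ.* + centre n
n[1+n]≡2*centre n = begin
  + n ℤ.* + suc n         ≡⟨ ℤP.pos-* n (suc n) ⟨
  + (n * suc n)           ≡⟨ cong (λ x → + x) (centre*2 n) ⟨
  + (centre n * 2)        ≡⟨ ℤP.pos-* (centre n) 2 ⟩
  + centre n ℤ.* + 2      ≡⟨ ℤP.*-comm (+ centre n) (+ 2) ⟩
  + 2 ℤ.* + centre n      ∎
  where open ≡-Reasoning

goodCount≡sumCount : ∀ n → goodCount n ≡ sumCount n n (+ centre n)
goodCount≡sumCount n = ≡.trans (length-filter≡count _ (allVecs n n))
  (∑-cong (λ v → 𝟙-cong _ _ (cong (λ x → + x)) ℤP.+-injective) (allVecs n n))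

deviation : ∀ n → Vec ℕ n → ℕ
deviation n v = ∣ + sum v ℤ.- + centre n ∣

∑-pos : {A : Set} (f : A → ℕ) (xs : List A) → ℤ∑.∑ (λ x → + f x) xs ≡ + ∑ f xs
∑-pos f []       = refl
∑-pos f (x ∷ xs) = ≡.trans (cong (λ y → + f x ℤ.+ y) (∑-pos f xs)) (≡.sym (ℤP.pos-+ (f x) (∑ f xs)))

∣i∣*∣i∣ : ∀ i → + (∣ i ∣ * ∣ i ∣) ≡ i ℤ.* i
∣i∣*∣i∣ (+ m)     = ℤP.pos-* m m
∣i∣*∣i∣ -[1+ m ] = refl

∑-deviation² : ∀ m → let n = suc m in
               12 * ∑ (λ v → deviation n v * deviation n v) (allVecs n n) + n ^ n * n ≡ n ^ n * n ^ 3
∑-deviation² m = ℤP.+-injective (begin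
  + (12 * M + N * n)                                        ≡⟨ ℤP.pos-+ (12 * M) (N * n) ⟩
  + (12 * M) ℤ.+ + (N * n)                                  ≡⟨ cong₂ ℤ._+_ (ℤP.pos-* 12 M) (ℤP.pos-* N n) ⟩
  + 12 ℤ.* + M ℤ.+ + N ℤ.* + n                              ≡⟨ cong (λ x → + 12 ℤ.* x ℤ.+ + N ℤ.* + n) M-as-ℤ ⟩
  + 12 ℤ.* ℤ∑.∑ (λ v → Y v ℤ.* Y v) V ℤ.+ + N ℤ.* + n
    ≡⟨ cong (ℤ._+ + N ℤ.* + n) (Moments.∑-centred² m (+ centre n) (n[1+n]≡2*centre n)) ⟩
  + N ℤ.* (+ n ℤ.* (+ n ℤ.* + n ℤ.- 1ℤ)) ℤ.+ + N ℤ.* + n    ≡⟨ cube (+ N) (+ n) ⟩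
  + N ℤ.* (+ n ℤ.* (+ n ℤ.* (+ n ℤ.* + 1)))                 ≡⟨ cong (λ x → + N ℤ.* x) cube-pos ⟨
  + N ℤ.* + (n ^ 3)                                         ≡⟨ ℤP.pos-* N (n ^ 3) ⟨
  + (N * n ^ 3)                                             ∎)
  where
  open ≡-Reasoning
  n = suc m
  N = n ^ n
  V = allVecs n n
  Y : Vec ℕ n → ℤ
  Y v = + sum v ℤ.- + centre n
  M = ∑ (λ v → deviation n v * deviation n v) V
  M-as-ℤ : + M ≡ ℤ∑.∑ (λ v → Y v ℤ.* Y v) V
  M-as-ℤ = ≡.trans (≡.sym (∑-pos _ V)) (ℤ∑.∑-cong (λ v → ∣i∣*∣i∣ (Y v)) V)
  cube : ∀ N n → N ℤ.* (n ℤ.* (n ℤ.* n ℤ.- 1ℤ)) ℤ.+ N ℤ.* n ≡ N ℤ.* (n ℤ.* (n ℤ.* (n ℤ.* + 1)))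
  cube = solve-∀
  cube-pos : + (n ^ 3) ≡ + n ℤ.* (+ n ℤ.* (+ n ℤ.* + 1))
  cube-pos = ≡.trans (ℤP.pos-* n (n * (n * 1)))
                     (cong (+ n ℤ.*_) (≡.trans (ℤP.pos-* n (n * 1)) (cong (+ n ℤ.*_) (ℤP.pos-* n 1))))

window : ∀ y R → ∣ y ∣ ≤ R → ∃[ j ] j < suc (2 * R) × y ≡ + j ℤ.- + R
window (+ a)     R a≤R   = R + a , s≤s (ℕP.+-monoʳ-≤ R (ℕP.≤-trans a≤R (ℕP.m≤m+n R 0))) , shift (+ a) (+ R)
  where
  shift : ∀ a R → a ≡ R ℤ.+ a ℤ.- R
  shift = solve-∀
window -[1+ a ] R 1+a≤R = R ∸ suc a , s≤s (ℕP.≤-trans (ℕP.m∸n≤m R (suc a)) (ℕP.m≤m+n R _)) ,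
                          ≡.trans (shift (+ suc a) (+ R)) (cong (ℤ._- + R) (≡.sym (pos-∸ 1+a≤R)))
  where
  shift : ∀ a R → ℤ.- a ≡ R ℤ.- a ℤ.- R
  shift = solve-∀

count-near-centre-≤ : ∀ n R → count (λ v → deviation n v <? suc R) (allVecs n n) ≤ suc (2 * R) * goodCount n
count-near-centre-≤ n R = begin
  count (λ v → deviation n v <? suc R) V
    ≤⟨ count-≤-∑< (λ v → deviation n v <? suc R) (λ j v → + sum v ℤ.≟ s j) cover V ⟩
  ∑< (suc (2 * R)) (λ j → sumCount n n (s j))
    ≤⟨ ∑-mono (λ j → sumCount-≤-centre n c (n[1+n]≡2*centre n) (s j)) (upTo (suc (2 * R))) ⟩
  ∑< (suc (2 * R)) (λ _ → sumCount n n c)         ≡⟨ ∑-const-upTo (suc (2 * R)) _ ⟩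
  sumCount n n c * suc (2 * R)                    ≡⟨ ℕP.*-comm _ (suc (2 * R)) ⟩
  suc (2 * R) * sumCount n n c                    ≡⟨ cong (suc (2 * R) *_) (goodCount≡sumCount n) ⟨
  suc (2 * R) * goodCount n                       ∎
  where
  open ℕP.≤-Reasoning
  V = allVecs n n
  c = + centre n
  s : ℕ → ℤ
  s j = c ℤ.+ (+ j ℤ.- + R)
  recentre : ∀ x c → x ≡ c ℤ.+ (x ℤ.- c)
  recentre = solve-∀
  cover : ∀ v → deviation n v < suc R → ∃[ j ] j < suc (2 * R) × + sum v ≡ s j
  cover v d<1+R with window (+ sum v ℤ.- c) R (ℕP.≤-pred d<1+R)
  ... | j , j<1+2R , eq = j , j<1+2R , ≡.trans (recentre (+ sum v) c) (cong (λ y → c ℤ.+ y) eq)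

half-near-centre : ∀ m R → let n = suc m in n ^ 3 ≤ 6 * (suc R * suc R) →
              n ^ n ≤ 2 * count (λ v → deviation n v <? suc R) (allVecs n n)
half-near-centre m R n³≤6s = ℕP.*-cancelˡ-≤ (6 * s) (ℕP.+-cancelˡ-≤ (6 * s * N) _ _ (begin
  6 * s * N + 6 * s * N          ≡⟨ double s N ⟩
  12 * (s * N)                   ≤⟨ ℕP.*-monoʳ-≤ 12 chebyshev′ ⟩
  12 * (M + s * W)               ≡⟨ ℕP.*-distribˡ-+ 12 M (s * W) ⟩
  12 * M + 12 * (s * W)          ≤⟨ ℕP.+-monoˡ-≤ _ 12M≤Nn³ ⟩
  N * n ^ 3 + 12 * (s * W)       ≤⟨ ℕP.+-monoˡ-≤ _ (ℕP.*-monoʳ-≤ N n³≤6s) ⟩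
  N * (6 * s) + 12 * (s * W)     ≡⟨ regroup N s W ⟩
  6 * s * N + 6 * s * (2 * W)    ∎))
  where
  open ℕP.≤-Reasoning
  n = suc m
  N = n ^ n
  s = suc R * suc R
  V = allVecs n n
  M = ∑ (λ v → deviation n v * deviation n v) V
  W = count (λ v → deviation n v <? suc R) V
  double : ∀ s N → 6 * s * N + 6 * s * N ≡ 12 * (s * N)
  double = ℕ-Solver.solve-∀
  regroup : ∀ N s W → N * (6 * s) + 12 * (s * W) ≡ 6 * s * N + 6 * s * (2 * W)
  regroup = ℕ-Solver.solve-∀
  chebyshev′ : s * N ≤ M + s * W
  chebyshev′ = ≡.subst (λ L → s * L ≤ M + s * W) (length-allVecs n n) (chebyshev (deviation n) (suc R) V)
  12M≤Nn³ : 12 * M ≤ N * n ^ 3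
  12M≤Nn³ = ≡.subst (12 * M ≤_) (∑-deviation² m) (ℕP.m≤m+n (12 * M) (N * n))

n^n≤4*[1+R]*goodCount : ∀ m R → let n = suc m in n ^ 3 ≤ 6 * (suc R * suc R) → n ^ n ≤ 4 * suc R * goodCount n
n^n≤4*[1+R]*goodCount m R n³≤6q² = begin
  n ^ n                                         ≤⟨ half-near-centre m R n³≤6q² ⟩
  2 * count (λ v → deviation n v <? suc R) V    ≤⟨ ℕP.*-monoʳ-≤ 2 (count-near-centre-≤ n R) ⟩
  2 * (suc (2 * R) * goodCount n)
    ≤⟨ ℕP.*-monoʳ-≤ 2 (ℕP.*-monoˡ-≤ (goodCount n) (ℕP.n≤1+n (suc (2 * R)))) ⟩
  2 * (suc (suc (2 * R)) * goodCount n)         ≡⟨ regroup R (goodCount n) ⟩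
  4 * suc R * goodCount n                       ∎
  where
  open ℕP.≤-Reasoning
  n = suc m
  V = allVecs n n
  regroup : ∀ R f → 2 * ((2 + 2 * R) * f) ≡ 4 * (1 + R) * f
  regroup = ℕ-Solver.solve-∀

n^[2n]≤[4*goodCount]²*[1+R]² : ∀ m R → let n = suc m in
                n ^ 3 ≤ 6 * (suc R * suc R) → n ^ (2 * n) ≤ (4 * goodCount n) ^ 2 * (suc R * suc R)
n^[2n]≤[4*goodCount]²*[1+R]² m R n³≤6q² = begin
  n ^ (2 * n)              ≡⟨ cong (λ k → n ^ (n + k)) (ℕP.+-identityʳ n) ⟩
  n ^ (n + n)              ≡⟨ ℕP.^-distribˡ-+-* n n n ⟩
  n ^ n * n ^ n            ≤⟨ ℕP.*-mono-≤ bound bound ⟩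
  4 * q * f * (4 * q * f)  ≡⟨ regroup q f ⟩
  (4 * f) ^ 2 * (q * q)    ∎
  where
  open ℕP.≤-Reasoning
  n = suc m
  q = suc R
  f = goodCount n
  bound : n ^ n ≤ 4 * q * f
  bound = n^n≤4*[1+R]*goodCount m R n³≤6q²
  -- (4 * f) ^ 2 unfolds to 4 * f * (4 * f * 1), the form the solver needs.
  regroup : ∀ q f → 4 * q * f * (4 * q * f) ≡ 4 * f * (4 * f * 1) * (q * q)
  regroup = ℕ-Solver.solve-∀

lemma5p2 : (n : ℕ) → 1 ≤ n → n ^ (2 * n) ≤ (4 * goodCount n) ^ 2 * n ^ 3
lemma5p2 (suc m) _ =
  let R , q²≤n³ , n³≤6q² = square-bracket (suc m ^ 3) (s≤s z≤n)
  in ℕP.≤-trans (n^[2n]≤[4*goodCount]²*[1+R]² m R n³≤6q²) (ℕP.*-monoʳ-≤ ((4 * goodCount (suc m)) ^ 2) q²≤n³)
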